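{- Let $\{u_n\}_{n=1}^\infty$ be Sylvester's sequence ($u_1=2$, $u_{n+1}=u_n^2-u_n+1$). Let $a_1<a_2<\cdots$ be a strictly increasing sequence of positive integers, different from $\{u_n\}$, with $\sum_{i=1}^\infty\frac1{a_i}=1$. Let $m$ be the smallest positive integer $s$ such that $a_i=u_i$ for all $1\le i\le s-1$ and $a_s>u_s$. Define the sequence $\{c_n\}_{n=1}^\infty$ by: $c_i=u_i$ for $1\le i\le m-1$; \[ c_m=\begin{cases}u_m,&m=1,\\ u_m+1,&m>1,\end{cases}\qquad c_{m+1}=\begin{cases}u_m^2,&m=1,\\ \frac{u_m^2}{2},&m>1,\end{cases}\qquad c_{m+2}=\begin{cases}\frac{u_m^3(u_m-1)+1}{2},&m=1,\\ \frac{u_m^2(u_m^2-1)+2}{2},&m>1;\end{cases} \] and $\{c_n\}_{n=m+3}^\infty$ is the infinite greedy Egyptian underapproximation of the unit fraction $\frac{1}{M}$, where $M=(u_m-1)c_mc_{m+1}c_{m+2}$ (a positive integer), i.e. $c_{m+3}=M+1$ and $c_{n+1}=c_n^2-c_n+1$ for $n\ge m+3$. Then for every integer $k\ge m$, \[ \sum_{i=1}^k\frac1{a_i}\le\sum_{i=1}^k\frac1{c_i}. \]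
   Context: Sylvester's sequence is $2,3,7,43,1807,\dots$; it satisfies $\sum_{i=1}^{n-1}1/u_i+1/(u_n-1)=1$ for all $n\ge1$. The infinite greedy Egyptian underapproximation of $1/M$ is defined recursively by $x_i=\lfloor(1/M-\sum_{j<i}1/x_j)^{ -1}\rfloor+1$. -}

module Defs where

open import Data.Nat as ℕ using (ℕ; zero; suc; _≡ᵇ_; _<ᵇ_)
open import Data.Bool using (if_then_else_)
open import Data.Rational as ℚ using (ℚ; 0ℚ; 1ℚ; _+_; _-_; _*_; _÷_; 1/_; ∣_∣; _<_; _≤_)
open import Data.Rational.Properties using (_≟_)
open import Data.Product using (∃)
open import Relation.Nullary using (yes; no)

-- Sylvester's sequence, 1-indexed: u 1 = 2, u (n+1) = u n ^ 2 - u n + 1.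
-- (u 0 = 0 is a dummy value, never used by the statement.)
sylv : ℕ → ℕ
sylv zero = 2
sylv (suc n) = let x = sylv n in x ℕ.* x ℕ.∸ x ℕ.+ 1

u : ℕ → ℕ
u zero = 0
u (suc n) = sylv n

q : ℕ → ℚ
q n = ℚ.fromℚᵘ (Data.Rational.Unnormalised.mkℚᵘ (ℤ.+ n) 0)
  where import Data.Rational.Unnormalised
        import Data.Integer as ℤ

-- reciprocal of a rational; convention 1/0 := 0 (never used on zero below,
-- since all terms are positive).
inv : ℚ → ℚ
inv p with p ≟ 0ℚ
... | yes _ = 0ℚ
... | no p≢0 = 1/_ p {{ℚ.≢-nonZero p≢0}}

S : (ℕ → ℚ) → ℕ → ℚ
S x zero = 0ℚ
S x (suc k) = S x k + inv (x (suc k))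

SumsTo : (ℕ → ℚ) → ℚ → Set
SumsTo x L = ∀ (ε : ℚ) → 0ℚ < ε → ∃ λ (N : ℕ) → ∀ (n : ℕ) → N ℕ.≤ n → ∣ S x n - L ∣ < ε

module _ (m : ℕ) where
  private
    U : ℚ
    U = q (u m)
    two : ℚ
    two = q 2
    isOne = m ≡ᵇ 1

  cm cm1 cm2 M : ℚ
  cm  = if isOne then U else U + 1ℚ
  cm1 = if isOne then U * U else (U * U) ÷ two
  cm2 = if isOne then (U * U * U * (U - 1ℚ) + 1ℚ) ÷ two
                 else (U * U * (U * U - 1ℚ) + q 2) ÷ two
  M = (U - 1ℚ) * cm * cm1 * cm2

  ctail : ℕ → ℚ
  ctail zero = M + 1ℚ
  ctail (suc j) = let x = ctail j in x * x - x + 1ℚ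

  c : ℕ → ℚ
  c i = if i <ᵇ m then q (u i)
        else if i ≡ᵇ m then cm
        else if i ≡ᵇ suc m then cm1
        else if i ≡ᵇ suc (suc m) then cm2
        else ctail (i ℕ.∸ (3 ℕ.+ m))

-- Up to index m - 1 both sequences are Sylvester's, whose reciprocals sum to
-- 1 - 1/D with D = u m - 1, so only the tails b j = a (m - 1 + j) and
-- γ j = c (m - 1 + j) need comparing.  Every partial sum of 1/b stays below
-- 1/D, and D b₁ ⋯ bₖ times the remaining gap is a positive integer, so the
-- gap is at least 1/(D b₁ ⋯ bₖ).  The sequence γ is chosen so that wherever
-- D b₁ ⋯ bₖ < D γ₁ ⋯ γₖ it is already the greedy expansion of 1/D, i.e.
-- Σ_{i ≤ k} 1/γ i = 1/D - 1/(D γ₁ ⋯ γₖ), which beats that gap.  Splitting at the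
-- last such k, the remaining terms satisfy b₁ ⋯ bₜ ≥ γ₁ ⋯ γₜ (relative to k),
-- and the Tomić–Weyl inequality, a consequence of AM–GM, compares their
-- reciprocal sums.

module Submission where

open import Defs
open import Data.Nat as ℕ using (ℕ; zero; suc; z≤n; s≤s; _<ᵇ_; _≡ᵇ_)
import Data.Nat.Properties as ℕ
import Data.Nat.Coprimality as Coprime
import Data.Integer as ℤ
import Data.Integer.Properties as ℤ
open import Data.Rational as ℚ
  using (ℚ; 0ℚ; 1ℚ; _+_; _-_; _*_; _÷_; mkℚ; _≤_; _<_; ∣_∣; positive; nonNegative)
open import Data.Rational.Properties
open import Data.Rational.Solver using (module +-*-Solver)
open +-*-Solver using (solve; _:=_; _:+_; _:-_; _:*_; con)
open import Data.Bool using (true; false; if_then_else_)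
open import Data.Bool.Properties using (T-≡; ¬-not)
open import Data.Empty using (⊥-elim)
open import Data.List using (List; []; _∷_; length)
open import Data.List.Relation.Unary.All using (All; []; _∷_)
open import Data.Product using (Σ; ∃; _×_; _,_; proj₁; proj₂)
open import Data.Sum using (_⊎_; inj₁; inj₂)
open import Data.Unit using (tt)
open import Function.Bundles using (Equivalence)
open import Relation.Binary.Definitions using (tri<; tri≈; tri>)
open import Relation.Binary.PropositionalEquality
  using (_≡_; _≢_; refl; sym; trans; cong; cong₂; subst; subst₂; module ≡-Reasoning)
open import Relation.Nullary using (yes; no; ¬_)
open import Relation.Nullary.Decidable using (toWitness)


q≡mkℚ : ∀ n → q n ≡ mkℚ (ℤ.+ n) 0 (Coprime.sym (Coprime.1-coprimeTo n))
q≡mkℚ n = normalize-coprime (Coprime.sym (Coprime.1-coprimeTo n))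

q-homo-+ : ∀ m n → q (m ℕ.+ n) ≡ q m + q n
q-homo-+ m n rewrite q≡mkℚ m | q≡mkℚ n | ℕ.*-identityʳ m | ℕ.*-identityʳ n =
  cong (ℚ._/ 1) (trans (ℤ.pos-+ m n) (sym (cong₂ ℤ._+_ (ℤ.+◃n≡+n m) (ℤ.+◃n≡+n n))))

q-homo-* : ∀ m n → q (m ℕ.* n) ≡ q m * q n
q-homo-* m n rewrite q≡mkℚ m | q≡mkℚ n = cong (ℚ._/ 1) (ℤ.pos-* m n)

q-homo-∸ : ∀ m n → n ℕ.≤ m → q (m ℕ.∸ n) ≡ q m - q n
q-homo-∸ m n n≤m = begin
  q (m ℕ.∸ n)             ≡⟨ solve 2 (λ x y → x := x :+ y :- y) refl (q (m ℕ.∸ n)) (q n) ⟩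
  q (m ℕ.∸ n) + q n - q n ≡⟨ cong (_- q n) (sym (q-homo-+ (m ℕ.∸ n) n)) ⟩
  q (m ℕ.∸ n ℕ.+ n) - q n ≡⟨ cong (λ x → q x - q n) (ℕ.m∸n+n≡m n≤m) ⟩
  q m - q n               ∎
  where open ≡-Reasoning

q-mono-≤ : ∀ {m n} → m ℕ.≤ n → q m ≤ q n
q-mono-≤ {m} {n} m≤n rewrite q≡mkℚ m | q≡mkℚ n =
  ℚ.*≤* (subst₂ ℤ._≤_ (sym (ℤ.*-identityʳ (ℤ.+ m))) (sym (ℤ.*-identityʳ (ℤ.+ n))) (ℤ.+≤+ m≤n))

q-mono-< : ∀ {m n} → m ℕ.< n → q m < q n
q-mono-< {m} {n} m<n rewrite q≡mkℚ m | q≡mkℚ n =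
  ℚ.*<* (subst₂ ℤ._<_ (sym (ℤ.*-identityʳ (ℤ.+ m))) (sym (ℤ.*-identityʳ (ℤ.+ n))) (ℤ.+<+ m<n))

q-cancel-< : ∀ {m n} → q m < q n → m ℕ.< n
q-cancel-< {m} {n} qm<qn with ℕ.<-cmp m n
... | tri< m<n _ _ = m<n
... | tri≈ _ refl _ = ⊥-elim (<-irrefl refl qm<qn)
... | tri> _ _ n<m = ⊥-elim (<-asym qm<qn (q-mono-< n<m))

q-pos : ∀ {n} → 1 ℕ.≤ n → 0ℚ < q n
q-pos = q-mono-<

0<1 : 0ℚ < 1ℚ
0<1 = positive⁻¹ 1ℚ

*-pos : ∀ {p r} → 0ℚ < p → 0ℚ < r → 0ℚ < p * r
*-pos {p} {r} 0<p 0<r = positive⁻¹ (p * r) {{pos*pos⇒pos p {{positive 0<p}} r {{positive 0<r}}}}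

*-nonNeg : ∀ {p r} → 0ℚ ≤ p → 0ℚ ≤ r → 0ℚ ≤ p * r
*-nonNeg {p} {r} 0≤p 0≤r =
  nonNegative⁻¹ (p * r) {{nonNeg*nonNeg⇒nonNeg p {{nonNegative 0≤p}} r {{nonNegative 0≤r}}}}

+1-pos : ∀ {p} → 0ℚ < p → 0ℚ < p + 1ℚ
+1-pos {p} 0<p = <-trans 0<p (≤-<-trans (≤-reflexive (sym (+-identityʳ p))) (+-monoʳ-< p 0<1))

p<q⇒0<q-p : ∀ {p r} → p < r → 0ℚ < r - p
p<q⇒0<q-p {p} lt = ≤-<-trans (≤-reflexive (sym (+-inverseʳ p))) (+-monoˡ-< (ℚ.- p) lt)

p≤q⇒0≤q-p : ∀ {p r} → p ≤ r → 0ℚ ≤ r - p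
p≤q⇒0≤q-p {p} le = ≤-trans (≤-reflexive (sym (+-inverseʳ p))) (+-monoˡ-≤ (ℚ.- p) le)

*-monoˡ-≤-0≤ : ∀ {p r} s → 0ℚ ≤ s → p ≤ r → s * p ≤ s * r
*-monoˡ-≤-0≤ s 0≤s = *-monoˡ-≤-nonNeg s {{nonNegative 0≤s}}

*-monoʳ-≤-0≤ : ∀ {p r} s → 0ℚ ≤ s → p ≤ r → p * s ≤ r * s
*-monoʳ-≤-0≤ s 0≤s = *-monoʳ-≤-nonNeg s {{nonNegative 0≤s}}

*-monoˡ-<-0< : ∀ {p r} s → 0ℚ < s → p < r → s * p < s * r
*-monoˡ-<-0< s 0<s = *-monoʳ-<-pos s {{positive 0<s}}

*-cancelʳ-≤-0< : ∀ {p r} s → 0ℚ < s → p * s ≤ r * s → p ≤ r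
*-cancelʳ-≤-0< s 0<s = *-cancelʳ-≤-pos s {{positive 0<s}}

*-cancelʳ-<-0< : ∀ {p r} s → 0ℚ < s → p * s < r * s → p < r
*-cancelʳ-<-0< s 0<s = *-cancelʳ-<-nonNeg s {{nonNegative (<⇒≤ 0<s)}}

*-mono-≤-0≤ : ∀ {p r s t} → 0ℚ ≤ p → 0ℚ ≤ s → p ≤ r → s ≤ t → p * s ≤ r * t
*-mono-≤-0≤ {p} {r} {s} {t} 0≤p 0≤s p≤r s≤t =
  ≤-trans (*-monoˡ-≤-0≤ p 0≤p s≤t) (*-monoʳ-≤-0≤ t (≤-trans 0≤s s≤t) p≤r)

-- `inv` is total (inv 0 = 0), so each fact below needs positivity.

inv-inverseʳ : ∀ {p} → 0ℚ < p → p * inv p ≡ 1ℚ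
inv-inverseʳ {p} 0<p with p ≟ 0ℚ
... | yes p≡0 = ⊥-elim (<-irrefl (sym p≡0) 0<p)
... | no p≢0 = *-inverseʳ p {{ℚ.≢-nonZero p≢0}}

inv-inverseˡ : ∀ {p} → 0ℚ < p → inv p * p ≡ 1ℚ
inv-inverseˡ {p} 0<p = trans (*-comm (inv p) p) (inv-inverseʳ 0<p)

inv-pos : ∀ {p} → 0ℚ < p → 0ℚ < inv p
inv-pos {p} 0<p with 0ℚ <? inv p
... | yes 0<ip = 0<ip
... | no 0≮ip = ⊥-elim (<-irrefl refl (<-≤-trans 0<1 (begin
  1ℚ          ≡⟨ sym (inv-inverseʳ 0<p) ⟩
  p * inv p   ≤⟨ *-monoˡ-≤-0≤ p (<⇒≤ 0<p) (≮⇒≥ 0≮ip) ⟩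
  p * 0ℚ      ≡⟨ *-zeroʳ p ⟩
  0ℚ          ∎)))
  where open ≤-Reasoning

inv-unique : ∀ {p x} → 0ℚ < p → x * p ≡ 1ℚ → x ≡ inv p
inv-unique {p} {x} 0<p xp≡1 = begin
  x               ≡⟨ sym (*-identityʳ x) ⟩
  x * 1ℚ          ≡⟨ cong (x *_) (sym (inv-inverseʳ 0<p)) ⟩
  x * (p * inv p) ≡⟨ sym (*-assoc x p (inv p)) ⟩
  x * p * inv p   ≡⟨ cong (_* inv p) xp≡1 ⟩
  1ℚ * inv p      ≡⟨ *-identityˡ (inv p) ⟩
  inv p           ∎
  where open ≡-Reasoning

inv-homo-* : ∀ {p r} → 0ℚ < p → 0ℚ < r → inv (p * r) ≡ inv p * inv r
inv-homo-* {p} {r} 0<p 0<r = sym (inv-unique (*-pos 0<p 0<r) (begin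
  inv p * inv r * (p * r)   ≡⟨ solve 4 (λ a b c d → a :* b :* (c :* d) := a :* c :* (b :* d)) refl (inv p) (inv r) p r ⟩
  inv p * p * (inv r * r)   ≡⟨ cong₂ _*_ (inv-inverseˡ 0<p) (inv-inverseˡ 0<r) ⟩
  1ℚ                        ∎))
  where open ≡-Reasoning

inv-antimono-≤ : ∀ {p r} → 0ℚ < p → p ≤ r → inv r ≤ inv p
inv-antimono-≤ {p} {r} 0<p p≤r = *-cancelʳ-≤-0< (p * r) (*-pos 0<p 0<r) (begin
  inv r * (p * r)    ≡⟨ solve 3 (λ a b c → a :* (b :* c) := b :* (c :* a)) refl (inv r) p r ⟩
  p * (r * inv r)    ≡⟨ cong (p *_) (inv-inverseʳ 0<r) ⟩
  p * 1ℚ             ≤⟨ *-monoˡ-≤-0≤ p (<⇒≤ 0<p) 1≤ip*r ⟩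
  p * (inv p * r)    ≡⟨ solve 3 (λ a b c → a :* (b :* c) := b :* (a :* c)) refl p (inv p) r ⟩
  inv p * (p * r)    ∎)
  where
  open ≤-Reasoning
  0<r = <-≤-trans 0<p p≤r
  1≤ip*r : 1ℚ ≤ inv p * r
  1≤ip*r = ≤-trans (≤-reflexive (sym (inv-inverseˡ 0<p))) (*-monoˡ-≤-0≤ (inv p) (<⇒≤ (inv-pos 0<p)) p≤r)

inv-antimono-< : ∀ {p r} → 0ℚ < p → p < r → inv r < inv p
inv-antimono-< {p} {r} 0<p p<r = *-cancelʳ-<-0< (p * r) (*-pos 0<p 0<r) (begin-strict
  inv r * (p * r)    ≡⟨ solve 3 (λ a b c → a :* (b :* c) := b :* (c :* a)) refl (inv r) p r ⟩
  p * (r * inv r)    ≡⟨ cong (p *_) (inv-inverseʳ 0<r) ⟩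
  p * 1ℚ             <⟨ *-monoˡ-<-0< p 0<p 1<ip*r ⟩
  p * (inv p * r)    ≡⟨ solve 3 (λ a b c → a :* (b :* c) := b :* (a :* c)) refl p (inv p) r ⟩
  inv p * (p * r)    ∎)
  where
  open ≤-Reasoning
  0<r = <-trans 0<p p<r
  1<ip*r : 1ℚ < inv p * r
  1<ip*r = ≤-<-trans (≤-reflexive (sym (inv-inverseˡ 0<p))) (*-monoˡ-<-0< (inv p) (inv-pos 0<p) p<r)

inv-telescope : ∀ {p} → 0ℚ < p → inv p - inv (p + 1ℚ) ≡ inv (p * (p + 1ℚ))
inv-telescope {p} 0<p = inv-unique (*-pos 0<p 0<p+1) (begin
  (inv p - inv (p + 1ℚ)) * (p * (p + 1ℚ))
    ≡⟨ solve 4 (λ a b x y → (a :- b) :* (x :* y) := a :* x :* y :- x :* (y :* b)) refl (inv p) (inv (p + 1ℚ)) p (p + 1ℚ) ⟩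
  inv p * p * (p + 1ℚ) - p * ((p + 1ℚ) * inv (p + 1ℚ))
    ≡⟨ cong₂ (λ s t → s * (p + 1ℚ) - p * t) (inv-inverseˡ 0<p) (inv-inverseʳ 0<p+1) ⟩
  1ℚ * (p + 1ℚ) - p * 1ℚ
    ≡⟨ solve 1 (λ x → con 1ℚ :* (x :+ con 1ℚ) :- x :* con 1ℚ := con 1ℚ) refl p ⟩
  1ℚ ∎)
  where
  open ≡-Reasoning
  0<p+1 = +1-pos 0<p

sumTo : (ℕ → ℚ) → ℕ → ℚ
sumTo f zero = 0ℚ
sumTo f (suc n) = sumTo f n + f (suc n)

prodTo : (ℕ → ℚ) → ℕ → ℚ
prodTo f zero = 1ℚ
prodTo f (suc n) = prodTo f n * f (suc n)

On[1,_] : ℕ → (ℕ → Set) → Set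
On[1, n ] P = ∀ i → 1 ℕ.≤ i → i ℕ.≤ n → P i

On-init : ∀ {n P} → On[1, suc n ] P → On[1, n ] P
On-init h i 1≤i i≤n = h i 1≤i (ℕ.m≤n⇒m≤1+n i≤n)

On-last : ∀ {n P} → On[1, suc n ] P → P (suc n)
On-last h = h _ (s≤s z≤n) ℕ.≤-refl

S≡sumTo-inv : ∀ x n → S x n ≡ sumTo (λ i → inv (x i)) n
S≡sumTo-inv x zero = refl
S≡sumTo-inv x (suc n) = cong (_+ inv (x (suc n))) (S≡sumTo-inv x n)

sumTo-+ : ∀ f k n → sumTo f (n ℕ.+ k) ≡ sumTo f k + sumTo (λ i → f (i ℕ.+ k)) n
sumTo-+ f k zero = sym (+-identityʳ (sumTo f k))
sumTo-+ f k (suc n) = trans (cong (_+ f (suc n ℕ.+ k)) (sumTo-+ f k n)) (+-assoc (sumTo f k) _ _)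

prodTo-+ : ∀ f k n → prodTo f (n ℕ.+ k) ≡ prodTo f k * prodTo (λ i → f (i ℕ.+ k)) n
prodTo-+ f k zero = sym (*-identityʳ (prodTo f k))
prodTo-+ f k (suc n) = trans (cong (_* f (suc n ℕ.+ k)) (prodTo-+ f k n)) (*-assoc (prodTo f k) _ _)

sumTo-cong : ∀ f g n → On[1, n ] (λ i → f i ≡ g i) → sumTo f n ≡ sumTo g n
sumTo-cong f g zero h = refl
sumTo-cong f g (suc n) h = cong₂ _+_ (sumTo-cong f g n (On-init h)) (On-last h)

prodTo-pos : ∀ f n → On[1, n ] (λ i → 0ℚ < f i) → 0ℚ < prodTo f n
prodTo-pos f zero h = 0<1
prodTo-pos f (suc n) h = *-pos (prodTo-pos f n (On-init h)) (On-last h)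

prodTo-homo-* : ∀ (f g : ℕ → ℚ) n → prodTo (λ i → f i * g i) n ≡ prodTo f n * prodTo g n
prodTo-homo-* f g zero = refl
prodTo-homo-* f g (suc n) = trans (cong (_* (f (suc n) * g (suc n))) (prodTo-homo-* f g n))
  (solve 4 (λ a b c d → a :* b :* (c :* d) := a :* c :* (b :* d)) refl (prodTo f n) (prodTo g n) (f (suc n)) (g (suc n)))

prodTo-inv : ∀ f n → On[1, n ] (λ i → 0ℚ < f i) → prodTo (λ i → inv (f i)) n ≡ inv (prodTo f n)
prodTo-inv f zero h = refl
prodTo-inv f (suc n) h = trans (cong (_* inv (f (suc n))) (prodTo-inv f n (On-init h)))
  (sym (inv-homo-* (prodTo-pos f n (On-init h)) (On-last h)))

sumTo-∸-const : ∀ (x : ℕ → ℚ) w n → sumTo (λ i → x i - w) n ≡ sumTo x n - w * q n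
sumTo-∸-const x w zero = solve 1 (λ w → con 0ℚ := con 0ℚ :- w :* con 0ℚ) refl w
sumTo-∸-const x w (suc n) = begin
  sumTo (λ i → x i - w) n + (x (suc n) - w) ≡⟨ cong (_+ (x (suc n) - w)) (sumTo-∸-const x w n) ⟩
  sumTo x n - w * q n + (x (suc n) - w)
    ≡⟨ solve 4 (λ s w k y → s :- w :* k :+ (y :- w) := s :+ y :- w :* (con 1ℚ :+ k)) refl (sumTo x n) w (q n) (x (suc n)) ⟩
  sumTo x n + x (suc n) - w * (1ℚ + q n)     ≡⟨ cong (λ t → sumTo x n + x (suc n) - w * t) (sym (q-homo-+ 1 n)) ⟩
  sumTo x (suc n) - w * q (suc n)            ∎
  where open ≡-Reasoning

sumTo-∸-const-* : ∀ (x z : ℕ → ℚ) w n → sumTo (λ i → (x i - w) * z i) n ≡ sumTo (λ i → x i * z i) n - w * sumTo z n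
sumTo-∸-const-* x z w zero = solve 1 (λ w → con 0ℚ := con 0ℚ :- w :* con 0ℚ) refl w
sumTo-∸-const-* x z w (suc n) = begin
  sumTo (λ i → (x i - w) * z i) n + (x (suc n) - w) * z (suc n)
    ≡⟨ cong (_+ (x (suc n) - w) * z (suc n)) (sumTo-∸-const-* x z w n) ⟩
  sumTo (λ i → x i * z i) n - w * sumTo z n + (x (suc n) - w) * z (suc n)
    ≡⟨ solve 5 (λ s w t y v → s :- w :* t :+ (y :- w) :* v := s :+ y :* v :- w :* (t :+ v)) refl
         (sumTo (λ i → x i * z i) n) w (sumTo z n) (x (suc n)) (z (suc n)) ⟩
  sumTo (λ i → x i * z i) (suc n) - w * sumTo z (suc n) ∎
  where open ≡-Reasoning

sumL prodL : List ℚ → ℚ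
sumL [] = 0ℚ
sumL (x ∷ xs) = x + sumL xs
prodL [] = 1ℚ
prodL (x ∷ xs) = x * prodL xs

data Remove (x : ℚ) : List ℚ → List ℚ → Set where
  here  : ∀ {xs} → Remove x (x ∷ xs) xs
  there : ∀ {y xs ys} → Remove x xs ys → Remove x (y ∷ xs) (y ∷ ys)

Remove-sumL : ∀ {x xs ys} → Remove x xs ys → sumL xs ≡ x + sumL ys
Remove-sumL here = refl
Remove-sumL {x} (there {y} {ys = ys} r) =
  trans (cong (y +_) (Remove-sumL r)) (solve 3 (λ a b c → a :+ (b :+ c) := b :+ (a :+ c)) refl y x (sumL ys))

Remove-prodL : ∀ {x xs ys} → Remove x xs ys → prodL xs ≡ x * prodL ys
Remove-prodL here = refl
Remove-prodL {x} (there {y} {ys = ys} r) =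
  trans (cong (y *_) (Remove-prodL r)) (solve 3 (λ a b c → a :* (b :* c) := b :* (a :* c)) refl y x (prodL ys))

Remove-length : ∀ {x xs ys} → Remove x xs ys → length xs ≡ suc (length ys)
Remove-length here = refl
Remove-length (there r) = cong suc (Remove-length r)

Remove-All : ∀ {P : ℚ → Set} {x xs ys} → Remove x xs ys → All P xs → P x × All P ys
Remove-All here (px ∷ pxs) = px , pxs
Remove-All (there r) (py ∷ pxs) with Remove-All r pxs
... | px , pys = px , py ∷ pys

all¬-or-remove : ∀ {P : ℚ → Set} → (∀ x → P x ⊎ ¬ P x) → ∀ xs →
                 All (λ x → ¬ P x) xs ⊎ Σ ℚ λ x → Σ (List ℚ) λ ys → P x × Remove x xs ys
all¬-or-remove P? [] = inj₁ []
all¬-or-remove P? (x ∷ xs) with P? x | all¬-or-remove P? xs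
... | inj₁ px | _ = inj₂ (x , xs , px , here)
... | inj₂ ¬px | inj₁ ¬ps = inj₁ (¬px ∷ ¬ps)
... | inj₂ _ | inj₂ (y , ys , py , r) = inj₂ (y , x ∷ ys , py , there r)

<-dec : ∀ p r → p < r ⊎ ¬ p < r
<-dec p r with p <? r
... | yes p<r = inj₁ p<r
... | no p≮r = inj₂ p≮r

all≥1⇒length≤sumL : ∀ xs → All (λ x → ¬ x < 1ℚ) xs → q (length xs) ≤ sumL xs
all≥1⇒length≤sumL [] [] = ≤-refl
all≥1⇒length≤sumL (x ∷ xs) (x≮1 ∷ h) =
  ≤-trans (≤-reflexive (q-homo-+ 1 (length xs))) (+-mono-≤ (≮⇒≥ x≮1) (all≥1⇒length≤sumL xs h))

prodL-nonNeg : ∀ xs → All (0ℚ <_) xs → 0ℚ ≤ prodL xs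
prodL-nonNeg [] [] = nonNegative⁻¹ 1ℚ
prodL-nonNeg (x ∷ xs) (0<x ∷ h) = *-nonNeg (<⇒≤ 0<x) (prodL-nonNeg xs h)

all≤1⇒prodL≤1 : ∀ xs → All (0ℚ <_) xs → All (λ x → ¬ 1ℚ < x) xs → prodL xs ≤ 1ℚ
all≤1⇒prodL≤1 [] [] [] = ≤-refl
all≤1⇒prodL≤1 (x ∷ xs) (0<x ∷ pos) (x≯1 ∷ h) =
  *-mono-≤-0≤ (<⇒≤ 0<x) (prodL-nonNeg xs pos) (≮⇒≥ x≯1) (all≤1⇒prodL≤1 xs pos h)

1+ab≤a+b : ∀ {a b} → a < 1ℚ → 1ℚ < b → 1ℚ + a * b ≤ a + b
1+ab≤a+b {a} {b} a<1 1<b = begin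
  1ℚ + a * b                       ≡⟨ sym (+-identityʳ (1ℚ + a * b)) ⟩
  1ℚ + a * b + 0ℚ                  ≤⟨ +-monoʳ-≤ (1ℚ + a * b) (*-nonNeg (<⇒≤ (p<q⇒0<q-p a<1)) (<⇒≤ (p<q⇒0<q-p 1<b))) ⟩
  1ℚ + a * b + (1ℚ - a) * (b - 1ℚ) ≡⟨ solve 2 (λ a b → con 1ℚ :+ a :* b :+ (con 1ℚ :- a) :* (b :- con 1ℚ) := a :+ b) refl a b ⟩
  a + b                            ∎
  where open ≤-Reasoning

-- If some factor is < 1, another is > 1; merging the two into their product
-- keeps the product and, by 1+ab≤a+b, does not increase the sum.
am-gmL : ∀ n xs → length xs ≡ n → All (0ℚ <_) xs → 1ℚ ≤ prodL xs → q n ≤ sumL xs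
am-gmL zero [] refl _ _ = ≤-refl
am-gmL (suc n) xs len pos 1≤∏ with all¬-or-remove (λ x → <-dec x 1ℚ) xs
... | inj₁ all≥1 = subst (λ k → q k ≤ sumL xs) len (all≥1⇒length≤sumL xs all≥1)
... | inj₂ (a , ys , a<1 , ra) with Remove-All ra pos | all¬-or-remove (λ x → <-dec 1ℚ x) ys
...   | 0<a , pos-ys | inj₁ all≤1 = ⊥-elim (<-irrefl refl (≤-<-trans 1≤∏ (begin-strict
  prodL xs     ≡⟨ Remove-prodL ra ⟩
  a * prodL ys ≤⟨ *-monoˡ-≤-0≤ a (<⇒≤ 0<a) (all≤1⇒prodL≤1 ys pos-ys all≤1) ⟩
  a * 1ℚ       ≡⟨ *-identityʳ a ⟩
  a            <⟨ a<1 ⟩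
  1ℚ           ∎)))
  where open ≤-Reasoning
...   | 0<a , pos-ys | inj₂ (b , zs , 1<b , rb) with Remove-All rb pos-ys
...     | 0<b , pos-zs = begin
  q (suc n)              ≡⟨ q-homo-+ 1 n ⟩
  1ℚ + q n               ≤⟨ +-monoʳ-≤ 1ℚ merged ⟩
  1ℚ + (a * b + sumL zs) ≡⟨ sym (+-assoc 1ℚ (a * b) (sumL zs)) ⟩
  1ℚ + a * b + sumL zs   ≤⟨ +-monoˡ-≤ (sumL zs) (1+ab≤a+b a<1 1<b) ⟩
  a + b + sumL zs        ≡⟨ +-assoc a b (sumL zs) ⟩
  a + (b + sumL zs)      ≡⟨ cong (a +_) (sym (Remove-sumL rb)) ⟩
  a + sumL ys            ≡⟨ sym (Remove-sumL ra) ⟩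
  sumL xs                ∎
  where
  open ≤-Reasoning
  length-merged : length (a * b ∷ zs) ≡ n
  length-merged = ℕ.suc-injective (trans (sym (trans (Remove-length ra) (cong suc (Remove-length rb)))) len)
  prod-merged : prodL (a * b ∷ zs) ≡ prodL xs
  prod-merged = trans (*-assoc a b (prodL zs))
    (sym (trans (Remove-prodL ra) (cong (a *_) (Remove-prodL rb))))
  merged : q n ≤ a * b + sumL zs
  merged = am-gmL n (a * b ∷ zs) length-merged (*-pos 0<a 0<b ∷ pos-zs) (≤-trans 1≤∏ (≤-reflexive (sym prod-merged)))

toList : (ℕ → ℚ) → ℕ → List ℚ
toList z zero = []
toList z (suc n) = z (suc n) ∷ toList z n

am-gm : ∀ z n → On[1, n ] (λ i → 0ℚ < z i) → 1ℚ ≤ prodTo z n → q n ≤ sumTo z n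
am-gm z n pos 1≤∏ = ≤-trans
  (am-gmL n (toList z n) (length-toList n) (All-toList n pos) (≤-trans 1≤∏ (≤-reflexive (sym (prodL-toList n)))))
  (≤-reflexive (sumL-toList n))
  where
  length-toList : ∀ n → length (toList z n) ≡ n
  length-toList zero = refl
  length-toList (suc n) = cong suc (length-toList n)
  sumL-toList : ∀ n → sumL (toList z n) ≡ sumTo z n
  sumL-toList zero = refl
  sumL-toList (suc n) = trans (cong (z (suc n) +_) (sumL-toList n)) (+-comm (z (suc n)) (sumTo z n))
  prodL-toList : ∀ n → prodL (toList z n) ≡ prodTo z n
  prodL-toList zero = refl
  prodL-toList (suc n) = trans (cong (z (suc n) *_) (prodL-toList n)) (*-comm (z (suc n)) (prodTo z n))
  All-toList : ∀ n → On[1, n ] (λ i → 0ℚ < z i) → All (0ℚ <_) (toList z n)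
  All-toList zero h = []
  All-toList (suc n) h = On-last h ∷ All-toList n (On-init h)

antitone⇒last≤ : ∀ (x : ℕ → ℚ) N → (∀ i → 1 ℕ.≤ i → i ℕ.< N → x (suc i) ≤ x i) → On[1, N ] (λ i → x N ≤ x i)
antitone⇒last≤ x zero anti i 1≤i i≤0 = ⊥-elim (ℕ.<⇒≱ 1≤i i≤0)
antitone⇒last≤ x (suc N) anti i 1≤i i≤N+1 with ℕ.m≤n⇒m<n∨m≡n i≤N+1
... | inj₂ refl = ≤-refl
... | inj₁ (s≤s i≤N) = ≤-trans (anti N (ℕ.≤-trans 1≤i i≤N) ℕ.≤-refl)
                                (antitone⇒last≤ x N (λ j 1≤j j<N → anti j 1≤j (ℕ.m<n⇒m<1+n j<N)) i 1≤i i≤N)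

-- Tomić–Weyl.  Induction on n after shifting x down by its last value w;
-- the shift costs w · n and, by AM–GM, gains w · Σ z ≥ w · n.
tomić-weyl : ∀ n (x z : ℕ → ℚ) → On[1, n ] (λ i → 0ℚ ≤ x i) → (∀ i → 1 ℕ.≤ i → i ℕ.< n → x (suc i) ≤ x i)
           → On[1, n ] (λ i → 0ℚ < z i) → (∀ t → t ℕ.≤ n → 1ℚ ≤ prodTo z t)
           → sumTo x n ≤ sumTo (λ i → x i * z i) n
tomić-weyl zero x z _ _ _ _ = ≤-refl
tomić-weyl (suc n) x z x≥0 anti z>0 ∏z≥1 = begin
  sumTo x n + w                          ≡⟨ solve 3 (λ s w k → s :+ w := s :- w :* k :+ w :* (con 1ℚ :+ k)) refl (sumTo x n) w (q n) ⟩
  sumTo x n - w * q n + w * (1ℚ + q n)   ≡⟨ cong₂ _+_ (sym (sumTo-∸-const x w n)) (cong (w *_) (sym (q-homo-+ 1 n))) ⟩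
  sumTo x′ n + w * q (suc n)             ≤⟨ +-mono-≤ ih (*-monoˡ-≤-0≤ w (On-last x≥0) (am-gm z (suc n) z>0 (∏z≥1 (suc n) ℕ.≤-refl))) ⟩
  sumTo (λ i → x′ i * z i) n + w * sumTo z (suc n)
    ≡⟨ cong (_+ w * sumTo z (suc n)) (sumTo-∸-const-* x z w n) ⟩
  sumTo (λ i → x i * z i) n - w * sumTo z n + w * (sumTo z n + z (suc n))
    ≡⟨ solve 4 (λ s w t v → s :- w :* t :+ w :* (t :+ v) := s :+ w :* v) refl (sumTo (λ i → x i * z i) n) w (sumTo z n) (z (suc n)) ⟩
  sumTo (λ i → x i * z i) n + w * z (suc n) ∎
  where
  open ≤-Reasoning
  w = x (suc n)
  x′ : ℕ → ℚ
  x′ i = x i - w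
  ih : sumTo x′ n ≤ sumTo (λ i → x′ i * z i) n
  ih = tomić-weyl n x′ z
    (λ i 1≤i i≤n → p≤q⇒0≤q-p (antitone⇒last≤ x (suc n) anti i 1≤i (ℕ.m≤n⇒m≤1+n i≤n)))
    (λ i 1≤i i<n → +-monoˡ-≤ (ℚ.- w) (anti i 1≤i (ℕ.m<n⇒m<1+n i<n)))
    (On-init z>0)
    (λ t t≤n → ∏z≥1 t (ℕ.m≤n⇒m≤1+n t≤n))

last-index : (R : ℕ → Set) → (∀ k → R k ⊎ ¬ R k) → ∀ j →
             Σ ℕ λ k → k ℕ.≤ j × (k ≡ 0 ⊎ R k) × (∀ t → k ℕ.< t → t ℕ.≤ j → ¬ R t)
last-index R R? zero = 0 , z≤n , inj₁ refl , λ t 0<t t≤0 → ⊥-elim (ℕ.<⇒≱ 0<t t≤0)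
last-index R R? (suc j) with R? (suc j) | last-index R R? j
... | inj₁ r | _ = suc j , ℕ.≤-refl , inj₂ r , λ t j<t t≤j → ⊥-elim (ℕ.<⇒≱ j<t t≤j)
... | inj₂ ¬r | k , k≤j , rk , none = k , ℕ.m≤n⇒m≤1+n k≤j , rk , none′
  where
  none′ : ∀ t → k ℕ.< t → t ℕ.≤ suc j → ¬ R t
  none′ t k<t t≤j+1 with ℕ.m≤n⇒m<n∨m≡n t≤j+1
  ... | inj₁ (s≤s t≤j) = none t k<t t≤j
  ... | inj₂ refl = ¬r

NatDiff : ℚ → Set
NatDiff r = Σ ℕ λ A → Σ ℕ λ B → r ≡ q A - q B

NatDiff-pos⇒≥1 : ∀ {r} → NatDiff r → 0ℚ < r → 1ℚ ≤ r
NatDiff-pos⇒≥1 {r} (A , B , r≡) 0<r = begin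
  1ℚ              ≡⟨ solve 1 (λ b → con 1ℚ := con 1ℚ :+ b :- b) refl (q B) ⟩
  1ℚ + q B - q B  ≡⟨ cong (_- q B) (sym (q-homo-+ 1 B)) ⟩
  q (suc B) - q B ≤⟨ +-monoˡ-≤ (ℚ.- q B) (q-mono-≤ B<A) ⟩
  q A - q B       ≡⟨ sym r≡ ⟩
  r               ∎
  where
  open ≤-Reasoning
  B<A : B ℕ.< A
  B<A = q-cancel-< (begin-strict
    q B             ≡⟨ solve 2 (λ a b → b := a :- (a :- b)) refl (q A) (q B) ⟩
    q A - (q A - q B) <⟨ +-monoʳ-< (q A) (neg-antimono-< (<-≤-trans 0<r (≤-reflexive r≡))) ⟩
    q A - 0ℚ        ≡⟨ +-identityʳ (q A) ⟩
    q A             ∎)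

NatDiff-*-q-∸-q : ∀ {r} n M → NatDiff r → NatDiff (r * q n - q M)
NatDiff-*-q-∸-q {r} n M (A , B , r≡) = A ℕ.* n , B ℕ.* n ℕ.+ M , (begin
  r * q n - q M                   ≡⟨ cong (λ s → s * q n - q M) r≡ ⟩
  (q A - q B) * q n - q M         ≡⟨ solve 4 (λ a b c m → (a :- b) :* c :- m := a :* c :- (b :* c :+ m)) refl (q A) (q B) (q n) (q M) ⟩
  q A * q n - (q B * q n + q M)   ≡⟨ cong₂ (λ s t → s - (t + q M)) (sym (q-homo-* A n)) (sym (q-homo-* B n)) ⟩
  q (A ℕ.* n) - (q (B ℕ.* n) + q M) ≡⟨ cong (q (A ℕ.* n) -_) (sym (q-homo-+ (B ℕ.* n) M)) ⟩
  q (A ℕ.* n) - q (B ℕ.* n ℕ.+ M) ∎)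
  where open ≡-Reasoning

module Comparison (D : ℕ) (b : ℕ → ℕ) (γ : ℕ → ℚ)
  (1≤D : 1 ℕ.≤ D)
  (1≤b : ∀ i → 1 ℕ.≤ i → 1 ℕ.≤ b i)
  (b-inc : ∀ i → 1 ℕ.≤ i → b i ℕ.< b (suc i))
  (γ>0 : ∀ i → 1 ℕ.≤ i → 0ℚ < γ i)
  (Σb<1/D : ∀ n → sumTo (λ i → inv (q (b i))) n < inv (q D))
  where

  P Q gap : ℕ → ℚ
  P k = q D * prodTo (λ i → q (b i)) k
  Q k = q D * prodTo γ k
  gap n = inv (q D) - sumTo (λ i → inv (q (b i))) n

  Behind : ℕ → Set
  Behind k = 1 ℕ.≤ k × P k < Q k

  Behind? : ∀ k → Behind k ⊎ ¬ Behind k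
  Behind? zero = inj₂ λ ()
  Behind? (suc k) with <-dec (P (suc k)) (Q (suc k))
  ... | inj₁ P<Q = inj₁ (s≤s z≤n , P<Q)
  ... | inj₂ P≮Q = inj₂ λ (_ , P<Q) → P≮Q P<Q

  qD>0 : 0ℚ < q D
  qD>0 = q-pos 1≤D

  qb>0 : ∀ i → 1 ℕ.≤ i → 0ℚ < q (b i)
  qb>0 i 1≤i = q-pos (1≤b i 1≤i)

  P>0 : ∀ k → 0ℚ < P k
  P>0 k = *-pos qD>0 (prodTo-pos _ k (λ i 1≤i _ → qb>0 i 1≤i))

  P-suc : ∀ n → P (suc n) ≡ P n * q (b (suc n))
  P-suc n = sym (*-assoc (q D) _ _)

  P-natural : ∀ n → Σ ℕ λ M → P n ≡ q M
  P-natural zero = D , *-identityʳ (q D)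
  P-natural (suc n) with P-natural n
  ... | M , P≡ = M ℕ.* b (suc n) , trans (P-suc n) (trans (cong (_* q (b (suc n))) P≡) (sym (q-homo-* M (b (suc n)))))

  gap*P-NatDiff : ∀ n → NatDiff (gap n * P n)
  gap*P-NatDiff zero = 1 , 0 , trans (cong₂ _*_ (+-identityʳ (inv (q D))) (*-identityʳ (q D))) (inv-inverseˡ qD>0)
  gap*P-NatDiff (suc n) with P-natural n
  ... | M , P≡ = subst NatDiff (sym gap*P-suc) (NatDiff-*-q-∸-q (b (suc n)) M (gap*P-NatDiff n))
    where
    open ≡-Reasoning
    β = q (b (suc n))
    gap*P-suc : gap (suc n) * P (suc n) ≡ gap n * P n * β - q M
    gap*P-suc = begin
      gap (suc n) * P (suc n)
        ≡⟨ cong₂ _*_ (solve 3 (λ d s i → d :- (s :+ i) := d :- s :- i) refl (inv (q D)) (sumTo (λ i → inv (q (b i))) n) (inv β)) (P-suc n) ⟩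
      (gap n - inv β) * (P n * β)
        ≡⟨ solve 4 (λ g i p c → (g :- i) :* (p :* c) := g :* p :* c :- p :* (i :* c)) refl (gap n) (inv β) (P n) β ⟩
      gap n * P n * β - P n * (inv β * β)
        ≡⟨ cong₂ (λ s t → gap n * P n * β - s * t) P≡ (inv-inverseˡ (qb>0 (suc n) (s≤s z≤n))) ⟩
      gap n * P n * β - q M * 1ℚ
        ≡⟨ cong (gap n * P n * β -_) (*-identityʳ (q M)) ⟩
      gap n * P n * β - q M ∎

  1/P≤gap : ∀ n → inv (P n) ≤ gap n
  1/P≤gap n = begin
    inv (P n)                   ≡⟨ sym (*-identityˡ (inv (P n))) ⟩
    1ℚ * inv (P n)              ≤⟨ *-monoʳ-≤-0≤ (inv (P n)) (<⇒≤ (inv-pos (P>0 n))) 1≤gap*P ⟩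
    gap n * P n * inv (P n)     ≡⟨ *-assoc (gap n) (P n) (inv (P n)) ⟩
    gap n * (P n * inv (P n))   ≡⟨ cong (gap n *_) (inv-inverseʳ (P>0 n)) ⟩
    gap n * 1ℚ                  ≡⟨ *-identityʳ (gap n) ⟩
    gap n                       ∎
    where
    open ≤-Reasoning
    1≤gap*P : 1ℚ ≤ gap n * P n
    1≤gap*P = NatDiff-pos⇒≥1 (gap*P-NatDiff n) (*-pos (p<q⇒0<q-p (Σb<1/D n)) (P>0 n))

  module _ (greedy : ∀ k → Behind k → inv (q D) - inv (Q k) ≤ sumTo (λ i → inv (γ i)) k) where

    prefix-bound : ∀ k → k ≡ 0 ⊎ Behind k → sumTo (λ i → inv (q (b i))) k ≤ sumTo (λ i → inv (γ i)) k
    prefix-bound k (inj₁ refl) = ≤-refl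
    prefix-bound k (inj₂ behind@(_ , P<Q)) = begin
      sumTo (λ i → inv (q (b i))) k ≡⟨ solve 2 (λ s d → s := d :- (d :- s)) refl (sumTo (λ i → inv (q (b i))) k) (inv (q D)) ⟩
      inv (q D) - gap k             ≤⟨ +-monoʳ-≤ (inv (q D)) (neg-antimono-≤ (≤-trans (<⇒≤ (inv-antimono-< (P>0 k) P<Q)) (1/P≤gap k))) ⟩
      inv (q D) - inv (Q k)         ≤⟨ greedy k behind ⟩
      sumTo (λ i → inv (γ i)) k     ∎
      where open ≤-Reasoning

  module _ (k n : ℕ) (P≤Q : P k ≤ Q k) (ahead : ∀ t → k ℕ.< t → t ℕ.≤ n ℕ.+ k → ¬ Behind t) where

    private
      shift : ℕ → ℕ
      shift i = i ℕ.+ k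
      1≤shift : ∀ i → 1 ℕ.≤ i → 1 ℕ.≤ shift i
      1≤shift i 1≤i = ℕ.≤-trans 1≤i (ℕ.m≤m+n i k)
      Γ B : ℕ → ℚ
      Γ = prodTo (λ i → γ (shift i))
      B = prodTo (λ i → q (b (shift i)))
      Γ>0 : ∀ t → 0ℚ < Γ t
      Γ>0 t = prodTo-pos _ t (λ i 1≤i _ → γ>0 (shift i) (1≤shift i 1≤i))

    Γ≤B : ∀ t → t ℕ.≤ n → Γ t ≤ B t
    Γ≤B zero _ = ≤-refl
    Γ≤B (suc t) t<n = *-cancelʳ-≤-0< (P k) (P>0 k) (begin
      Γ (suc t) * P k          ≤⟨ *-monoˡ-≤-0≤ (Γ (suc t)) (<⇒≤ (Γ>0 (suc t))) P≤Q ⟩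
      Γ (suc t) * Q k          ≡⟨ solve 3 (λ g d p → g :* (d :* p) := d :* (p :* g)) refl (Γ (suc t)) (q D) (prodTo γ k) ⟩
      q D * (prodTo γ k * Γ (suc t)) ≡⟨ cong (q D *_) (sym (prodTo-+ γ k (suc t))) ⟩
      Q (suc t ℕ.+ k)          ≤⟨ ≮⇒≥ (λ P<Q → ahead (suc t ℕ.+ k) (s≤s (ℕ.m≤n+m k t)) (ℕ.+-monoˡ-≤ k t<n) (s≤s z≤n , P<Q)) ⟩
      P (suc t ℕ.+ k)          ≡⟨ cong (q D *_) (prodTo-+ _ k (suc t)) ⟩
      q D * (prodTo (λ i → q (b i)) k * B (suc t)) ≡⟨ solve 3 (λ d p g → d :* (p :* g) := g :* (d :* p)) refl (q D) (prodTo (λ i → q (b i)) k) (B (suc t)) ⟩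
      B (suc t) * P k          ∎)
      where open ≤-Reasoning

    segment-bound : sumTo (λ i → inv (q (b (shift i)))) n ≤ sumTo (λ i → inv (γ (shift i))) n
    segment-bound = ≤-trans
      (tomić-weyl n (λ i → inv (q (b (shift i)))) ratio
        (λ i 1≤i _ → <⇒≤ (inv-pos (qb>0 (shift i) (1≤shift i 1≤i))))
        (λ i 1≤i _ → inv-antimono-≤ (qb>0 (shift i) (1≤shift i 1≤i)) (q-mono-≤ (ℕ.<⇒≤ (b-inc (shift i) (1≤shift i 1≤i)))))
        (λ i 1≤i _ → *-pos (qb>0 (shift i) (1≤shift i 1≤i)) (inv-pos (γ>0 (shift i) (1≤shift i 1≤i))))
        ∏ratio≥1)
      (≤-reflexive (sumTo-cong _ _ n λ i 1≤i _ → cancel (qb>0 (shift i) (1≤shift i 1≤i))))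
      where
      ratio : ℕ → ℚ
      ratio i = q (b (shift i)) * inv (γ (shift i))
      ∏ratio≥1 : ∀ t → t ℕ.≤ n → 1ℚ ≤ prodTo ratio t
      ∏ratio≥1 t t≤n = begin
        1ℚ              ≡⟨ sym (inv-inverseʳ (Γ>0 t)) ⟩
        Γ t * inv (Γ t) ≤⟨ *-monoʳ-≤-0≤ (inv (Γ t)) (<⇒≤ (inv-pos (Γ>0 t))) (Γ≤B t t≤n) ⟩
        B t * inv (Γ t) ≡⟨ cong (B t *_) (sym (prodTo-inv _ t (λ i 1≤i _ → γ>0 (shift i) (1≤shift i 1≤i)))) ⟩
        B t * prodTo (λ i → inv (γ (shift i))) t ≡⟨ sym (prodTo-homo-* _ _ t) ⟩
        prodTo ratio t  ∎
        where open ≤-Reasoning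
      cancel : ∀ {β g} → 0ℚ < β → inv β * (β * g) ≡ g
      cancel {β} {g} β>0 = trans (sym (*-assoc (inv β) β g)) (trans (cong (_* g) (inv-inverseˡ β>0)) (*-identityˡ g))

  comparison : (∀ k → Behind k → inv (q D) - inv (Q k) ≤ sumTo (λ i → inv (γ i)) k)
             → ∀ j → sumTo (λ i → inv (q (b i))) j ≤ sumTo (λ i → inv (γ i)) j
  comparison greedy j with last-index Behind Behind? j
  ... | k , k≤j , k-behind , ahead = begin
    sumTo xb j                               ≡⟨ cong (sumTo xb) j≡ ⟩
    sumTo xb (n ℕ.+ k)                       ≡⟨ sumTo-+ xb k n ⟩
    sumTo xb k + sumTo (λ i → xb (i ℕ.+ k)) n ≤⟨ +-mono-≤ (prefix-bound greedy k k-behind) (segment-bound k n (P≤Q k-behind) ahead′) ⟩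
    sumTo xg k + sumTo (λ i → xg (i ℕ.+ k)) n ≡⟨ sym (sumTo-+ xg k n) ⟩
    sumTo xg (n ℕ.+ k)                       ≡⟨ cong (sumTo xg) (sym j≡) ⟩
    sumTo xg j                               ∎
    where
    open ≤-Reasoning
    xb xg : ℕ → ℚ
    xb i = inv (q (b i))
    xg i = inv (γ i)
    n = j ℕ.∸ k
    j≡ : j ≡ n ℕ.+ k
    j≡ = sym (ℕ.m∸n+n≡m k≤j)
    ahead′ : ∀ t → k ℕ.< t → t ℕ.≤ n ℕ.+ k → ¬ Behind t
    ahead′ t k<t t≤ = ahead t k<t (subst (t ℕ.≤_) (sym j≡) t≤)
    P≤Q : k ≡ 0 ⊎ Behind k → P k ≤ Q k
    P≤Q (inj₁ refl) = ≤-refl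
    P≤Q (inj₂ (_ , P<Q)) = <⇒≤ P<Q

sylv≥2 : ∀ n → 2 ℕ.≤ sylv n
sylv≥2 zero = ℕ.≤-refl
sylv≥2 (suc n) = ℕ.≤-trans (sylv≥2 n) (ℕ.≤-trans (ℕ.m≤m+n x 1) (ℕ.+-monoˡ-≤ 1 x≤x*x∸x))
  where
  x = sylv n
  x≤x*x∸x : x ℕ.≤ x ℕ.* x ℕ.∸ x
  x≤x*x∸x = ℕ.≤-trans (ℕ.≤-reflexive (sym (ℕ.m+n∸n≡m x x)))
    (ℕ.∸-monoˡ-≤ x (ℕ.≤-trans (ℕ.≤-reflexive (cong (x ℕ.+_) (sym (ℕ.+-identityʳ x)))) (ℕ.*-monoˡ-≤ x (sylv≥2 n))))

sylv-pred-suc : ∀ n → sylv (suc n) ℕ.∸ 1 ≡ (sylv n ℕ.∸ 1) ℕ.* sylv n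
sylv-pred-suc n = begin
  x ℕ.* x ℕ.∸ x ℕ.+ 1 ℕ.∸ 1 ≡⟨ ℕ.m+n∸n≡m (x ℕ.* x ℕ.∸ x) 1 ⟩
  x ℕ.* x ℕ.∸ x             ≡⟨ cong (x ℕ.* x ℕ.∸_) (sym (ℕ.*-identityˡ x)) ⟩
  x ℕ.* x ℕ.∸ 1 ℕ.* x       ≡⟨ sym (ℕ.*-distribʳ-∸ x x 1) ⟩
  (x ℕ.∸ 1) ℕ.* x           ∎
  where
  open ≡-Reasoning
  x = sylv n

sylvester-S : ∀ n → S (λ i → q (u i)) n ≡ 1ℚ - inv (q (sylv n ℕ.∸ 1))
sylvester-S zero = refl
sylvester-S (suc n) = begin
  S (λ i → q (u i)) n + inv (q x)  ≡⟨ cong (_+ inv (q x)) (sylvester-S n) ⟩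
  1ℚ - inv y + inv (q x)           ≡⟨ solve 2 (λ a b → con 1ℚ :- a :+ b := con 1ℚ :- (a :- b)) refl (inv y) (inv (q x)) ⟩
  1ℚ - (inv y - inv (q x))         ≡⟨ cong (λ t → 1ℚ - (inv y - inv t)) qx≡y+1 ⟩
  1ℚ - (inv y - inv (y + 1ℚ))      ≡⟨ cong (1ℚ -_) (inv-telescope y>0) ⟩
  1ℚ - inv (y * (y + 1ℚ))          ≡⟨ cong (λ t → 1ℚ - inv (y * t)) (sym qx≡y+1) ⟩
  1ℚ - inv (y * q x)               ≡⟨ cong (λ t → 1ℚ - inv t) (sym (trans (cong q (sylv-pred-suc n)) (q-homo-* (x ℕ.∸ 1) x))) ⟩
  1ℚ - inv (q (sylv (suc n) ℕ.∸ 1)) ∎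
  where
  open ≡-Reasoning
  x = sylv n
  y = q (x ℕ.∸ 1)
  1≤x : 1 ℕ.≤ x
  1≤x = ℕ.≤-trans (s≤s z≤n) (sylv≥2 n)
  qx≡y+1 : q x ≡ y + 1ℚ
  qx≡y+1 = trans (cong q (sym (ℕ.m∸n+n≡m 1≤x))) (q-homo-+ (x ℕ.∸ 1) 1)
  y>0 : 0ℚ < y
  y>0 = q-pos (ℕ.∸-monoˡ-≤ 1 (sylv≥2 n))

S<sum : ∀ x L → (∀ i → 1 ℕ.≤ i → 0ℚ < x i) → SumsTo x L → ∀ n → S x n < L
S<sum x L x>0 sums n with <-dec (S x n) L
... | inj₁ Sn<L = Sn<L
... | inj₂ Sn≮L = ⊥-elim (far (sums ε ε>0))
  where
  S-suc : ∀ k → S x k < S x (suc k)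
  S-suc k = ≤-<-trans (≤-reflexive (sym (+-identityʳ (S x k)))) (+-monoʳ-< (S x k) (inv-pos (x>0 (suc k) (s≤s z≤n))))
  S-mono : ∀ d k → S x k ≤ S x (d ℕ.+ k)
  S-mono zero k = ≤-refl
  S-mono (suc d) k = ≤-trans (S-mono d k) (<⇒≤ (S-suc (d ℕ.+ k)))
  ε = S x (suc n) - L
  ε>0 : 0ℚ < ε
  ε>0 = p<q⇒0<q-p (≤-<-trans (≮⇒≥ Sn≮L) (S-suc n))
  ε≤dist : ∀ k → suc n ℕ.≤ k → ε ≤ ∣ S x k - L ∣
  ε≤dist k n<k = ≤-trans ε≤S-L (≤-reflexive (sym (0≤p⇒∣p∣≡p (≤-trans (<⇒≤ ε>0) ε≤S-L))))
    where
    ε≤S-L : ε ≤ S x k - L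
    ε≤S-L = +-monoˡ-≤ (ℚ.- L) (≤-trans (S-mono (k ℕ.∸ suc n) (suc n)) (≤-reflexive (cong (S x) (ℕ.m∸n+n≡m n<k))))
  far : ¬ Σ ℕ λ N → ∀ k → N ℕ.≤ k → ∣ S x k - L ∣ < ε
  far (N , close) = <-irrefl refl (≤-<-trans (ε≤dist (N ℕ.⊔ suc n) (ℕ.m≤n⊔m N (suc n))) (close (N ℕ.⊔ suc n) (ℕ.m≤m⊔n N (suc n))))

<ᵇ-true : ∀ {i n} → i ℕ.< n → (i <ᵇ n) ≡ true
<ᵇ-true i<n = Equivalence.to T-≡ (ℕ.<⇒<ᵇ i<n)

<ᵇ-false : ∀ {i n} → n ℕ.≤ i → (i <ᵇ n) ≡ false
<ᵇ-false {i} {n} n≤i = ¬-not λ i<ᵇn≡true → ℕ.<⇒≱ (ℕ.<ᵇ⇒< i n (Equivalence.from T-≡ i<ᵇn≡true)) n≤i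

≡ᵇ-refl : ∀ n → (n ≡ᵇ n) ≡ true
≡ᵇ-refl n = Equivalence.to T-≡ (ℕ.≡⇒≡ᵇ n n refl)

≡ᵇ-false : ∀ {i n} → n ℕ.< i → (i ≡ᵇ n) ≡ false
≡ᵇ-false {i} {n} n<i = ¬-not λ i≡ᵇn≡true → ℕ.<⇒≢ n<i (sym (ℕ.≡ᵇ⇒≡ i n (Equivalence.from T-≡ i≡ᵇn≡true)))

if-true : ∀ {A : Set} {b} {x y : A} → b ≡ true → (if b then x else y) ≡ x
if-true refl = refl

if-false : ∀ {A : Set} {b} {x y : A} → b ≡ false → (if b then x else y) ≡ y
if-false refl = refl

c-below : ∀ m i → i ℕ.< m → c m i ≡ q (u i)
c-below m i i<m = if-true (<ᵇ-true i<m)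

c-at : ∀ m → c m m ≡ cm m
c-at m = trans (if-false (<ᵇ-false {m} ℕ.≤-refl)) (if-true (≡ᵇ-refl m))

c-at+1 : ∀ m → c m (suc m) ≡ cm1 m
c-at+1 m = trans (if-false (<ᵇ-false {suc m} {m} (ℕ.n≤1+n m)))
          (trans (if-false (≡ᵇ-false {suc m} {m} ℕ.≤-refl)) (if-true (≡ᵇ-refl m)))

c-at+2 : ∀ m → c m (2 ℕ.+ m) ≡ cm2 m
c-at+2 m = trans (if-false (<ᵇ-false {2 ℕ.+ m} {m} (ℕ.m≤n+m m 2)))
          (trans (if-false (≡ᵇ-false {2 ℕ.+ m} {m} (ℕ.m<n+m m {2} (s≤s z≤n))))
          (trans (if-false (≡ᵇ-false {2 ℕ.+ m} {suc m} ℕ.≤-refl)) (if-true (≡ᵇ-refl m))))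

c-after : ∀ m t → c m (3 ℕ.+ t ℕ.+ m) ≡ ctail m t
c-after m t = trans (if-false (<ᵇ-false {3 ℕ.+ t ℕ.+ m} {m} (ℕ.m≤n+m m (3 ℕ.+ t))))
             (trans (if-false (≡ᵇ-false {3 ℕ.+ t ℕ.+ m} {m} (ℕ.m<n+m m {3 ℕ.+ t} (s≤s z≤n))))
             (trans (if-false (≡ᵇ-false {3 ℕ.+ t ℕ.+ m} {suc m} (s≤s (ℕ.m<n+m m {2 ℕ.+ t} (s≤s z≤n)))))
             (trans (if-false (≡ᵇ-false {3 ℕ.+ t ℕ.+ m} {2 ℕ.+ m} (s≤s (s≤s (ℕ.m<n+m m {1 ℕ.+ t} (s≤s z≤n))))))
                    (cong (ctail m) (ℕ.m+n∸n≡m t m)))))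

-- γ (k + 1) = Q k + 1 says that γ continues as the greedy Egyptian
-- underapproximation of 1/d; Greedy k is the resulting exact remainder.
module GreedyTail (d : ℚ) (γ : ℕ → ℚ) where

  Q : ℕ → ℚ
  Q k = d * prodTo γ k

  Greedy : ℕ → Set
  Greedy k = 0ℚ < Q k × sumTo (λ i → inv (γ i)) k ≡ inv d - inv (Q k)

  Q-suc : ∀ k → Q (suc k) ≡ Q k * γ (suc k)
  Q-suc k = sym (*-assoc d (prodTo γ k) (γ (suc k)))

  greedy-step : ∀ k → γ (suc k) ≡ Q k + 1ℚ → Greedy k → Greedy (suc k)
  greedy-step k γ≡ (Q>0 , Σ≡) = subst (0ℚ <_) (sym Q-suc′) (*-pos Q>0 (+1-pos Q>0)) , (begin
    sumTo (λ i → inv (γ i)) k + inv (γ (suc k)) ≡⟨ cong₂ (λ s g → s + inv g) Σ≡ γ≡ ⟩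
    inv d - inv (Q k) + inv (Q k + 1ℚ)            ≡⟨ solve 3 (λ a b c → a :- b :+ c := a :- (b :- c)) refl (inv d) (inv (Q k)) (inv (Q k + 1ℚ)) ⟩
    inv d - (inv (Q k) - inv (Q k + 1ℚ))          ≡⟨ cong (inv d -_) (inv-telescope Q>0) ⟩
    inv d - inv (Q k * (Q k + 1ℚ))                ≡⟨ cong (λ x → inv d - inv x) (sym Q-suc′) ⟩
    inv d - inv (Q (suc k))                       ∎)
    where
    open ≡-Reasoning
    Q-suc′ : Q (suc k) ≡ Q k * (Q k + 1ℚ)
    Q-suc′ = trans (Q-suc k) (cong (Q k *_) γ≡)

  greedy-from : ∀ k₀ → (∀ t → γ (suc (k₀ ℕ.+ t)) ≡ Q (k₀ ℕ.+ t) + 1ℚ) → Greedy k₀ → ∀ t → Greedy (k₀ ℕ.+ t)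
  greedy-from k₀ γ≡ g₀ zero = subst Greedy (sym (ℕ.+-identityʳ k₀)) g₀
  greedy-from k₀ γ≡ g₀ (suc t) =
    subst Greedy (sym (ℕ.+-suc k₀ t)) (greedy-step (k₀ ℕ.+ t) (γ≡ t) (greedy-from k₀ γ≡ g₀ t))

  greedy-pos : ∀ k₀ → (∀ t → γ (suc (k₀ ℕ.+ t)) ≡ Q (k₀ ℕ.+ t) + 1ℚ) → Greedy k₀
             → (∀ i → 1 ℕ.≤ i → i ℕ.≤ k₀ → 0ℚ < γ i) → ∀ i → 1 ℕ.≤ i → 0ℚ < γ i
  greedy-pos k₀ γ≡ g₀ γ>0 i 1≤i with ℕ.≤-<-connex i k₀
  ... | inj₁ i≤k₀ = γ>0 i 1≤i i≤k₀
  ... | inj₂ k₀<i with ℕ.m≤n⇒∃[o]m+o≡n k₀<i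
  ...   | t , refl = subst (0ℚ <_) (sym (γ≡ t))
                       (+1-pos (proj₁ (greedy-from k₀ γ≡ g₀ t)))

S-after-sylvester-prefix : ∀ x m′ → (∀ i → 1 ℕ.≤ i → i ℕ.≤ m′ → x i ≡ q (u i)) → ∀ j →
  S x (j ℕ.+ m′) ≡ (1ℚ - inv (q (u (suc m′) ℕ.∸ 1))) + sumTo (λ i → inv (x (i ℕ.+ m′))) j
S-after-sylvester-prefix x m′ prefix j = begin
  S x (j ℕ.+ m′)                                              ≡⟨ S≡sumTo-inv x (j ℕ.+ m′) ⟩
  sumTo (λ i → inv (x i)) (j ℕ.+ m′)                          ≡⟨ sumTo-+ _ m′ j ⟩
  sumTo (λ i → inv (x i)) m′ + sumTo (λ i → inv (x (i ℕ.+ m′))) j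
    ≡⟨ cong (_+ tail) (sumTo-cong _ _ m′ λ i 1≤i i≤m′ → cong inv (prefix i 1≤i i≤m′)) ⟩
  sumTo (λ i → inv (q (u i))) m′ + sumTo (λ i → inv (x (i ℕ.+ m′))) j
    ≡⟨ cong (_+ tail) (trans (sym (S≡sumTo-inv _ m′)) (sylvester-S m′)) ⟩
  (1ℚ - inv (q (u (suc m′) ℕ.∸ 1))) + sumTo (λ i → inv (x (i ℕ.+ m′))) j ∎
  where
  open ≡-Reasoning
  tail = sumTo (λ i → inv (x (i ℕ.+ m′))) j

-- m = m′ + 1 and D = u m - 1; both tails are re-indexed from m: b j = a (j + m′), γ j = c m (j + m′).
module Reduction (a : ℕ → ℕ) (1≤a : ∀ i → 1 ℕ.≤ i → 1 ℕ.≤ a i) (a-inc : ∀ i → 1 ℕ.≤ i → a i ℕ.< a (suc i))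
  (Σa≡1 : SumsTo (λ i → q (a i)) 1ℚ) (m′ : ℕ) (prefix : ∀ i → 1 ℕ.≤ i → i ℕ.< suc m′ → a i ≡ u i) where

  D : ℕ
  D = u (suc m′) ℕ.∸ 1

  γ : ℕ → ℚ
  γ j = c (suc m′) (j ℕ.+ m′)

  1≤D : 1 ℕ.≤ D
  1≤D = ℕ.∸-monoˡ-≤ 1 (sylv≥2 m′)

  b : ℕ → ℕ
  b j = a (j ℕ.+ m′)

  1≤shift : ∀ i → 1 ℕ.≤ i → 1 ℕ.≤ i ℕ.+ m′
  1≤shift i 1≤i = ℕ.≤-trans 1≤i (ℕ.m≤m+n i m′)

  split : ∀ x → (∀ i → 1 ℕ.≤ i → i ℕ.< suc m′ → x i ≡ q (u i)) → ∀ j →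
          S x (j ℕ.+ m′) ≡ (1ℚ - inv (q D)) + sumTo (λ i → inv (x (i ℕ.+ m′))) j
  split x prefix-x = S-after-sylvester-prefix x m′ λ i 1≤i i≤m′ → prefix-x i 1≤i (s≤s i≤m′)

  Sa-split = split (λ i → q (a i)) λ i 1≤i i≤m′ → cong q (prefix i 1≤i i≤m′)
  Sc-split = split (c (suc m′)) λ i _ i≤m′ → c-below (suc m′) i i≤m′

  Σb<1/D : ∀ n → sumTo (λ i → inv (q (b i))) n < inv (q D)
  Σb<1/D n = begin-strict
    Σb                                       ≡⟨ solve 2 (λ y d → y := con 1ℚ :- d :+ y :+ (d :- con 1ℚ)) refl Σb (inv (q D)) ⟩
    (1ℚ - inv (q D) + Σb) + (inv (q D) - 1ℚ) <⟨ +-monoˡ-< (inv (q D) - 1ℚ) (subst (_< 1ℚ) (Sa-split n) S<1) ⟩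
    1ℚ + (inv (q D) - 1ℚ)                    ≡⟨ solve 1 (λ d → con 1ℚ :+ (d :- con 1ℚ) := d) refl (inv (q D)) ⟩
    inv (q D)                                ∎
    where
    open ≤-Reasoning
    Σb = sumTo (λ i → inv (q (b i))) n
    S<1 = S<sum (λ i → q (a i)) 1ℚ (λ i 1≤i → q-pos (1≤a i 1≤i)) Σa≡1 (n ℕ.+ m′)

  module C (γ>0 : ∀ i → 1 ℕ.≤ i → 0ℚ < γ i) = Comparison D b γ 1≤D
    (λ i 1≤i → 1≤a (i ℕ.+ m′) (1≤shift i 1≤i)) (λ i 1≤i → a-inc (i ℕ.+ m′) (1≤shift i 1≤i)) γ>0 Σb<1/D

  γ-after : ∀ t → γ (suc (3 ℕ.+ t)) ≡ ctail (suc m′) t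
  γ-after t = trans (cong (c (suc m′)) (sym (ℕ.+-suc (3 ℕ.+ t) m′))) (c-after (suc m′) t)

  open GreedyTail (q D) γ

  qD≡U-1 : q D ≡ q (u (suc m′)) - 1ℚ
  qD≡U-1 = q-homo-∸ (u (suc m′)) 1 (ℕ.≤-trans (s≤s z≤n) (sylv≥2 m′))

  M≡Q3 : M (suc m′) ≡ Q 3
  M≡Q3 = begin
    (U - 1ℚ) * cm m * cm1 m * cm2 m    ≡⟨ cong (λ x → x * cm m * cm1 m * cm2 m) (sym qD≡U-1) ⟩
    q D * cm m * cm1 m * cm2 m         ≡⟨ sym (cong₂ (λ x y → q D * x * y * cm2 m) (c-at m) (c-at+1 m)) ⟩
    q D * γ 1 * γ 2 * cm2 m            ≡⟨ sym (cong (q D * γ 1 * γ 2 *_) (c-at+2 m)) ⟩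
    q D * γ 1 * γ 2 * γ 3              ≡⟨ solve 4 (λ d x y z → d :* x :* y :* z := d :* (con 1ℚ :* x :* y :* z)) refl (q D) (γ 1) (γ 2) (γ 3) ⟩
    Q 3                                ∎
    where
    open ≡-Reasoning
    m = suc m′
    U = q (u m)

  γ-after-greedy : ∀ t → γ (suc (3 ℕ.+ t)) ≡ Q (3 ℕ.+ t) + 1ℚ
  γ-after-greedy zero = trans (γ-after 0) (cong (_+ 1ℚ) M≡Q3)
  γ-after-greedy (suc t) = begin
    γ (5 ℕ.+ t)                   ≡⟨ γ-after (suc t) ⟩
    x * x - x + 1ℚ                ≡⟨ cong (λ y → y * y - y + 1ℚ) (trans (sym (γ-after t)) (γ-after-greedy t)) ⟩
    (Q′ + 1ℚ) * (Q′ + 1ℚ) - (Q′ + 1ℚ) + 1ℚ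
      ≡⟨ solve 1 (λ y → (y :+ con 1ℚ) :* (y :+ con 1ℚ) :- (y :+ con 1ℚ) :+ con 1ℚ := y :* (y :+ con 1ℚ) :+ con 1ℚ) refl Q′ ⟩
    Q′ * (Q′ + 1ℚ) + 1ℚ           ≡⟨ cong (λ y → Q′ * y + 1ℚ) (sym (γ-after-greedy t)) ⟩
    Q′ * γ (4 ℕ.+ t) + 1ℚ         ≡⟨ cong (_+ 1ℚ) (sym (Q-suc (3 ℕ.+ t))) ⟩
    Q (4 ℕ.+ t) + 1ℚ              ∎
    where
    open ≡-Reasoning
    x = ctail (suc m′) t
    Q′ = Q (3 ℕ.+ t)

  reduction : (γ>0 : ∀ i → 1 ℕ.≤ i → 0ℚ < γ i)
            → (∀ k → C.Behind γ>0 k → inv (q D) - inv (C.Q γ>0 k) ≤ sumTo (λ i → inv (γ i)) k)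
            → ∀ k → suc m′ ℕ.≤ k → S (λ i → q (a i)) k ≤ S (c (suc m′)) k
  reduction γ>0 greedy k m≤k = begin
    S (λ i → q (a i)) k                                        ≡⟨ cong (S (λ i → q (a i))) k≡ ⟩
    S (λ i → q (a i)) (j ℕ.+ m′)                               ≡⟨ Sa-split j ⟩
    (1ℚ - inv (q D)) + sumTo (λ i → inv (q (b i))) j          ≤⟨ +-monoʳ-≤ (1ℚ - inv (q D)) (C.comparison γ>0 greedy j) ⟩
    (1ℚ - inv (q D)) + sumTo (λ i → inv (γ i)) j              ≡⟨ sym (Sc-split j) ⟩
    S (c (suc m′)) (j ℕ.+ m′)                                 ≡⟨ cong (S (c (suc m′))) (sym k≡) ⟩
    S (c (suc m′)) k                                          ∎
    where
    open ≤-Reasoning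
    j = k ℕ.∸ m′
    k≡ : k ≡ j ℕ.+ m′
    k≡ = sym (ℕ.m∸n+n≡m (ℕ.≤-trans (ℕ.n≤1+n m′) m≤k))

≤⇒≯ : ∀ {p r} → r ≤ p → ¬ p < r
≤⇒≯ r≤p p<r = <-irrefl refl (<-≤-trans p<r r≤p)

inv-sum-two : ∀ {d x y} → 0ℚ < d → 0ℚ < x → 0ℚ < y → x * y - d * y - d * x ≡ 1ℚ
            → inv x + inv y ≡ inv d - inv (d * x * y)
inv-sum-two {d} {x} {y} d>0 x>0 y>0 key = begin
  inv x + inv y                       ≡⟨ solve 2 (λ s e → s := e :- (e :- s)) refl (inv x + inv y) (inv d) ⟩
  inv d - (inv d - (inv x + inv y))   ≡⟨ cong (inv d -_) (inv-unique (*-pos (*-pos d>0 x>0) y>0) gap*dxy≡1) ⟩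
  inv d - inv (d * x * y)             ∎
  where
  open ≡-Reasoning
  gap*dxy≡1 : (inv d - (inv x + inv y)) * (d * x * y) ≡ 1ℚ
  gap*dxy≡1 = begin
    (inv d - (inv x + inv y)) * (d * x * y)
      ≡⟨ solve 6 (λ e f g d x y → (e :- (f :+ g)) :* (d :* x :* y) := e :* d :* (x :* y) :- f :* x :* (d :* y) :- g :* y :* (d :* x))
           refl (inv d) (inv x) (inv y) d x y ⟩
    inv d * d * (x * y) - inv x * x * (d * y) - inv y * y * (d * x)
      ≡⟨ cong₂ (λ s t → s * (x * y) - t * (d * y) - inv y * y * (d * x)) (inv-inverseˡ d>0) (inv-inverseˡ x>0) ⟩
    1ℚ * (x * y) - 1ℚ * (d * y) - inv y * y * (d * x)
      ≡⟨ cong (λ s → 1ℚ * (x * y) - 1ℚ * (d * y) - s * (d * x)) (inv-inverseˡ y>0) ⟩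
    1ℚ * (x * y) - 1ℚ * (d * y) - 1ℚ * (d * x)
      ≡⟨ cong₂ (λ s t → s - t - 1ℚ * (d * x)) (*-identityˡ (x * y)) (*-identityˡ (d * y)) ⟩
    x * y - d * y - 1ℚ * (d * x)
      ≡⟨ cong (x * y - d * y -_) (*-identityˡ (d * x)) ⟩
    x * y - d * y - d * x
      ≡⟨ key ⟩
    1ℚ ∎

module Case-m≡1 (a : ℕ → ℕ) (1≤a : ∀ i → 1 ℕ.≤ i → 1 ℕ.≤ a i) (a-inc : ∀ i → 1 ℕ.≤ i → a i ℕ.< a (suc i))
  (Σa≡1 : SumsTo (λ i → q (a i)) 1ℚ) (prefix : ∀ i → 1 ℕ.≤ i → i ℕ.< 1 → a i ≡ u i) (u1<a1 : u 1 ℕ.< a 1) where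

  open Reduction a 1≤a a-inc Σa≡1 0 prefix
  open GreedyTail (q D) γ

  -- γ = 2, 4, 9/2, … and D = 1, so Q 3 = 36 and Σ_{i ≤ 3} 1/γ i = 35/36.
  greedy₃ : Greedy 3
  greedy₃ = toWitness {a? = 0ℚ <? Q 3} tt , refl

  γ>0 : ∀ i → 1 ℕ.≤ i → 0ℚ < γ i
  γ>0 = greedy-pos 3 γ-after-greedy greedy₃ γ>0₃
    where
    γ>0₃ : ∀ i → 1 ℕ.≤ i → i ℕ.≤ 3 → 0ℚ < γ i
    γ>0₃ 1 _ _ = toWitness {a? = 0ℚ <? γ 1} tt
    γ>0₃ 2 _ _ = toWitness {a? = 0ℚ <? γ 2} tt
    γ>0₃ 3 _ _ = toWitness {a? = 0ℚ <? γ 3} tt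
    γ>0₃ (suc (suc (suc (suc _)))) _ (s≤s (s≤s (s≤s ())))

  a1≥3 : 3 ℕ.≤ a 1
  a1≥3 = u1<a1

  greedy : ∀ k → C.Behind γ>0 k → inv (q D) - inv (Q k) ≤ sumTo (λ i → inv (γ i)) k
  greedy 1 (_ , P<Q) = ⊥-elim (≤⇒≯ Q≤P P<Q)
    where
    Q≤P : Q 1 ≤ q 1 * (1ℚ * q (a 1))
    Q≤P = ≤-trans (toWitness {a? = Q 1 ≤? q 3} tt) (subst (q 3 ≤_) (sym (trans (*-identityˡ _) (*-identityˡ _))) (q-mono-≤ a1≥3))
  greedy 2 (_ , P<Q) = ⊥-elim (≤⇒≯ Q≤P P<Q)
    where
    Q≤P : Q 2 ≤ q 1 * (1ℚ * q (a 1) * q (a 2))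
    Q≤P = ≤-trans (toWitness {a? = Q 2 ≤? q 1 * (1ℚ * q 3 * q 4)} tt)
      (*-monoˡ-≤-0≤ (q 1) (nonNegative⁻¹ (q 1)) (*-mono-≤-0≤ (nonNegative⁻¹ (1ℚ * q 3)) (nonNegative⁻¹ (q 4))
        (*-monoˡ-≤-0≤ 1ℚ (nonNegative⁻¹ 1ℚ) (q-mono-≤ a1≥3)) (q-mono-≤ (ℕ.≤-trans (s≤s a1≥3) (a-inc 1 (s≤s z≤n))))))
  greedy (suc (suc (suc t))) _ = ≤-reflexive (sym (proj₂ (greedy-from 3 γ-after-greedy greedy₃ t)))

  result : ∀ k → 1 ℕ.≤ k → S (λ i → q (a i)) k ≤ S (c 1) k
  result = reduction γ>0 greedy

module Case-m≥2 (a : ℕ → ℕ) (1≤a : ∀ i → 1 ℕ.≤ i → 1 ℕ.≤ a i) (a-inc : ∀ i → 1 ℕ.≤ i → a i ℕ.< a (suc i))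
  (Σa≡1 : SumsTo (λ i → q (a i)) 1ℚ) (n : ℕ) (prefix : ∀ i → 1 ℕ.≤ i → i ℕ.< suc (suc n) → a i ≡ u i)
  (um<am : u (suc (suc n)) ℕ.< a (suc (suc n))) where

  open Reduction a 1≤a a-inc Σa≡1 (suc n) prefix
  open GreedyTail (q D) γ

  m = suc (suc n)
  U ½ : ℚ
  U = q (u m)
  ½ = 1ℚ ÷ q 2

  U>0 : 0ℚ < U
  U>0 = q-pos (ℕ.≤-trans (s≤s z≤n) (sylv≥2 (suc n)))

  qD>0 : 0ℚ < q D
  qD>0 = q-pos 1≤D

  γ₁≡ : γ 1 ≡ U + 1ℚ
  γ₁≡ = c-at m

  γ₂≡ : γ 2 ≡ U * U * ½
  γ₂≡ = c-at+1 m

  γ₃≡ : γ 3 ≡ (U * U * (U * U - 1ℚ) + q 2) * ½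
  γ₃≡ = c-at+2 m

  γ₁>0 : 0ℚ < γ 1
  γ₁>0 = subst (0ℚ <_) (sym γ₁≡) (+1-pos U>0)

  γ₂>0 : 0ℚ < γ 2
  γ₂>0 = subst (0ℚ <_) (sym γ₂≡) (*-pos (*-pos U>0 U>0) (toWitness {a? = 0ℚ <? ½} tt))

  Q₂≡ : Q 2 ≡ q D * γ 1 * γ 2
  Q₂≡ = solve 3 (λ d x y → d :* (con 1ℚ :* x :* y) := d :* x :* y) refl (q D) (γ 1) (γ 2)

  2*½≡1 : q 2 * ½ ≡ 1ℚ
  2*½≡1 = refl

  -- Both identities are polynomial in U once 2 · ½ = 1 is used.
  +2*½-1 : ∀ p → p + (q 2 * ½ - 1ℚ) ≡ p
  +2*½-1 p = trans (cong (λ h → p + (h - 1ℚ)) 2*½≡1) (solve 1 (λ p → p :+ (con 1ℚ :- con 1ℚ) := p) refl p)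

  greedy₂ : Greedy 2
  greedy₂ = subst (0ℚ <_) (sym Q₂≡) (*-pos (*-pos qD>0 γ₁>0) γ₂>0) , (begin
    0ℚ + inv (γ 1) + inv (γ 2)        ≡⟨ cong (_+ inv (γ 2)) (+-identityˡ (inv (γ 1))) ⟩
    inv (γ 1) + inv (γ 2)             ≡⟨ inv-sum-two qD>0 γ₁>0 γ₂>0 key ⟩
    inv (q D) - inv (q D * γ 1 * γ 2) ≡⟨ cong (λ x → inv (q D) - inv x) (sym Q₂≡) ⟩
    inv (q D) - inv (Q 2)             ∎)
    where
    open ≡-Reasoning
    key : γ 1 * γ 2 - q D * γ 2 - q D * γ 1 ≡ 1ℚ
    key = begin
      γ 1 * γ 2 - q D * γ 2 - q D * γ 1
        ≡⟨ cong₂ (λ x y → x * y - q D * y - q D * x) γ₁≡ γ₂≡ ⟩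
      (U + 1ℚ) * (U * U * ½) - q D * (U * U * ½) - q D * (U + 1ℚ)
        ≡⟨ cong (λ d → (U + 1ℚ) * (U * U * ½) - d * (U * U * ½) - d * (U + 1ℚ)) qD≡U-1 ⟩
      (U + 1ℚ) * (U * U * ½) - (U - 1ℚ) * (U * U * ½) - (U - 1ℚ) * (U + 1ℚ)
        ≡⟨ solve 2 (λ U h → (U :+ con 1ℚ) :* (U :* U :* h) :- (U :- con 1ℚ) :* (U :* U :* h) :- (U :- con 1ℚ) :* (U :+ con 1ℚ)
                          := con 1ℚ :+ U :* U :* (con (q 2) :* h :- con 1ℚ)) refl U ½ ⟩
      1ℚ + U * U * (q 2 * ½ - 1ℚ)
        ≡⟨ cong (λ h → 1ℚ + U * U * (h - 1ℚ)) 2*½≡1 ⟩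
      1ℚ + U * U * (1ℚ - 1ℚ)
        ≡⟨ solve 1 (λ U → con 1ℚ :+ U :* U :* (con 1ℚ :- con 1ℚ) := con 1ℚ) refl U ⟩
      1ℚ ∎

  γ₃≡Q₂+1 : γ 3 ≡ Q 2 + 1ℚ
  γ₃≡Q₂+1 = begin
    γ 3                                         ≡⟨ γ₃≡ ⟩
    (U * U * (U * U - 1ℚ) + q 2) * ½
      ≡⟨ solve 2 (λ U h → (U :* U :* (U :* U :- con 1ℚ) :+ con (q 2)) :* h
                        := (U :- con 1ℚ) :* (U :+ con 1ℚ) :* (U :* U :* h) :+ con 1ℚ :+ (con (q 2) :* h :- con 1ℚ)) refl U ½ ⟩
    (U - 1ℚ) * (U + 1ℚ) * (U * U * ½) + 1ℚ + (q 2 * ½ - 1ℚ) ≡⟨ +2*½-1 _ ⟩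
    (U - 1ℚ) * (U + 1ℚ) * (U * U * ½) + 1ℚ      ≡⟨ cong₂ (λ d x → d * x * (U * U * ½) + 1ℚ) (sym qD≡U-1) (sym γ₁≡) ⟩
    q D * γ 1 * (U * U * ½) + 1ℚ                ≡⟨ cong (λ y → q D * γ 1 * y + 1ℚ) (sym γ₂≡) ⟩
    q D * γ 1 * γ 2 + 1ℚ                        ≡⟨ cong (_+ 1ℚ) (sym Q₂≡) ⟩
    Q 2 + 1ℚ                                    ∎
    where open ≡-Reasoning

  γ-after₂ : ∀ t → γ (suc (2 ℕ.+ t)) ≡ Q (2 ℕ.+ t) + 1ℚ
  γ-after₂ zero = γ₃≡Q₂+1
  γ-after₂ (suc t) = γ-after-greedy t

  γ>0 : ∀ i → 1 ℕ.≤ i → 0ℚ < γ i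
  γ>0 = greedy-pos 2 γ-after₂ greedy₂ γ>0₂
    where
    γ>0₂ : ∀ i → 1 ℕ.≤ i → i ℕ.≤ 2 → 0ℚ < γ i
    γ>0₂ 1 _ _ = γ₁>0
    γ>0₂ 2 _ _ = γ₂>0
    γ>0₂ (suc (suc (suc _))) _ (s≤s (s≤s ()))

  greedy : ∀ k → C.Behind γ>0 k → inv (q D) - inv (Q k) ≤ sumTo (λ i → inv (γ i)) k
  greedy 1 (_ , P<Q) = ⊥-elim (≤⇒≯ Q≤P P<Q)
    where
    γ₁≤am : γ 1 ≤ q (a m)
    γ₁≤am = ≤-trans (≤-reflexive (trans γ₁≡ (trans (+-comm U 1ℚ) (sym (q-homo-+ 1 (u m)))))) (q-mono-≤ um<am)
    Q≤P : Q 1 ≤ q D * (1ℚ * q (a m))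
    Q≤P = *-monoˡ-≤-0≤ (q D) (<⇒≤ qD>0) (*-monoˡ-≤-0≤ 1ℚ (nonNegative⁻¹ 1ℚ) γ₁≤am)
  greedy (suc (suc t)) _ = ≤-reflexive (sym (proj₂ (greedy-from 2 γ-after₂ greedy₂ t)))

  result : ∀ k → m ℕ.≤ k → S (λ i → q (a i)) k ≤ S (c m) k
  result = reduction γ>0 greedy

lemma3p3 : (a : ℕ → ℕ)
    → (∀ i → 1 ℕ.≤ i → 1 ℕ.≤ a i)
    → (∀ i → 1 ℕ.≤ i → a i ℕ.< a (suc i))
    → (∃ λ i → 1 ℕ.≤ i × a i ≢ u i)
    → SumsTo (λ i → q (a i)) 1ℚ
    → (m : ℕ) → 1 ℕ.≤ m
    → (∀ i → 1 ℕ.≤ i → i ℕ.< m → a i ≡ u i) → u m ℕ.< a m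
    → (∀ s → 1 ℕ.≤ s → (∀ i → 1 ℕ.≤ i → i ℕ.< s → a i ≡ u i) → u s ℕ.< a s → m ℕ.≤ s)
    → ∀ k → m ℕ.≤ k → S (λ i → q (a i)) k ℚ.≤ S (c m) k
lemma3p3 a 1≤a a-inc _ Σa≡1 1 _ prefix um<am _ = Case-m≡1.result a 1≤a a-inc Σa≡1 prefix um<am
lemma3p3 a 1≤a a-inc _ Σa≡1 (suc (suc n)) _ prefix um<am _ = Case-m≥2.result a 1≤a a-inc Σa≡1 n prefix um<am
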